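{- Fix an integer $\Delta \geq 2$. Let $A \subseteq \{s,\ell,m,r\}^*$ be the CodeSet$^\Delta$ (defined in the context). Then the map sending a $T^\Delta$ tree to its codeword is a bijection from the set of all $T^\Delta$ trees onto the set $\{ s\delta : \delta \in A\}$ of words obtained by prefixing the letter $s$ to an element of $A$. In particular, every word $s\delta$ with $\delta\in A$ is the codeword of exactly one $T^\Delta$ tree.
   Context: A $T^\Delta$ tree is an unlabeled ordered (plane) rooted tree in which every node has at most $\Delta$ children; formally it has a root $r$ and, if it has more than one node, $r$ is joined to an ordered sequence of $j\le\Delta$ subtrees $T_1,\dots,T_j$, each recursively a $T^\Delta$ tree. The codeword of a $T^\Delta$ tree $T$ is the word over the alphabet $\{s,\ell,m,r\}$ obtained as follows: the root is labeled $s$; for every internal node, if it has exactly one child that child is labeled $s$, and otherwise its leftmost child is labeled $\ell$, its rightmost child is labeled $r$, and all children strictly between them are labeled $m$; the codeword is the sequence of labels read in pre-order (root, then subtrees from left to right). The CodeSet$^\Delta$ is the smallest set $A$ of words over $\{s,\ell,m,r\}$ such that: (1) the empty word $\epsilon$ is in $A$; (2) for all $x\in A$, $sx\in A$; (3) for all $2\le i\le\Delta$ and all $x_1,\dots,x_i\in A$, the word $\ell x_1 m x_2 m x_3 \cdots m x_{i-1} r x_i$ is in $A$. -}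

module Defs where

open import Data.Nat using (ℕ; _≤_)
open import Data.List using (List; []; _∷_; _++_; length; concat; map)
open import Data.List.Relation.Unary.All using (All)

data Letter : Set where
  s ℓ m r : Letter

Word : Set
Word = List Letter

data Tree (Δ : ℕ) : Set where
  node : (ts : List (Tree Δ)) → length ts ≤ Δ → Tree Δ

mutual
  codeFrom : {Δ : ℕ} → Letter → Tree Δ → Word
  codeFrom lab (node ts _) = lab ∷ children ts

  children : {Δ : ℕ} → List (Tree Δ) → Word
  children []           = []
  children (t ∷ [])     = codeFrom s t
  children (t ∷ u ∷ us) = codeFrom ℓ t ++ rightPart u us

  rightPart : {Δ : ℕ} → Tree Δ → List (Tree Δ) → Word
  rightPart u []       = codeFrom r u
  rightPart u (v ∷ vs) = codeFrom m u ++ rightPart v vs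

codeword : {Δ : ℕ} → Tree Δ → Word
codeword t = codeFrom s t

-- For words x₁ … x_i (i ≥ 2), the word  m x₂ m x₃ ⋯ m x_{i-1} r x_i
-- built from x₂ , (x₃ ∷ … ∷ x_i).
tailWord : Word → List Word → Word
tailWord x []       = r ∷ x
tailWord x (y ∷ ys) = (m ∷ x) ++ tailWord y ys

-- ℓ x₁ m x₂ ⋯ m x_{i-1} r x_i  for the list x₁ ∷ x₂ ∷ xs
branchWord : Word → Word → List Word → Word
branchWord x₁ x₂ xs = (ℓ ∷ x₁) ++ tailWord x₂ xs

data CodeSet (Δ : ℕ) : Word → Set where
  cs-ε : CodeSet Δ []
  cs-s : ∀ {x} → CodeSet Δ x → CodeSet Δ (s ∷ x)
  cs-branch : ∀ {x₁ x₂ xs} →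
    length (x₁ ∷ x₂ ∷ xs) ≤ Δ →
    CodeSet Δ x₁ → CodeSet Δ x₂ → All (CodeSet Δ) xs →
    CodeSet Δ (branchWord x₁ x₂ xs)

module Submission where

-- Write  body t  for the codeword of  t  with its root label
-- removed, so  codeFrom a t = a ∷ body t  and, for a node with children
-- ts,  body = children ts.
--  * Injectivity (unique parsing): a complete code block  codeFrom a t
--    can only be followed by a word that is empty or starts with m or r
--    (a "continuation").  Under this invariant the first letter after a
--    node label decides the number of children (none / one child s /
--    several children ℓ), so one mutual induction recovers both the tree
--    and the remaining word from  codeFrom a t ++ w.
--  * Soundness: body t ∈ CodeSet, by induction on t; a node with at least
--    two children has  body = branchWord  of the children's bodies.
--  * Completeness: every δ ∈ CodeSet is  children ts  for a list ts of at
--    most Δ trees, by induction on the derivation of δ ∈ CodeSet.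
-- Injectivity and soundness hold for every Δ; completeness needs 1 ≤ Δ
-- (for the rule δ ↦ sδ).

open import Defs
open import Data.Nat using (ℕ; _≤_; suc; z≤n)
open import Data.Nat.Properties using (≤-irrelevant; ≤-trans; n≤1+n)
open import Data.List using (List; []; _∷_; _++_; length; map)
open import Data.List.Properties using (∷-injective; ++-assoc; ++-identityʳ; length-map)
open import Data.List.Relation.Unary.All using (All; []; _∷_)
open import Data.Product using (Σ; _×_; _,_; proj₁; proj₂)
open import Relation.Binary.PropositionalEquality
  using (_≡_; refl; sym; trans; cong; cong₂; subst)

-- Words that may follow a complete code block inside a codeword: the end
-- of the word, or the label of a further (middle or right) sibling.
data Continuation : Word → Set where
  end    : Continuation []
  middle : ∀ {w} → Continuation (m ∷ w)
  right  : ∀ {w} → Continuation (r ∷ w)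

rightPart-continuation : ∀ {Δ} (u : Tree Δ) us w → Continuation (rightPart u us ++ w)
rightPart-continuation (node _ _) []      w = right
rightPart-continuation (node _ _) (_ ∷ _) w = middle

reassoc : ∀ (a b c a′ b′ c′ : Word) →
  (a ++ b) ++ c ≡ (a′ ++ b′) ++ c′ → a ++ (b ++ c) ≡ a′ ++ (b′ ++ c′)
reassoc a b c a′ b′ c′ eq = trans (sym (++-assoc a b c)) (trans eq (++-assoc a′ b′ c′))

mutual
  parse-tree : ∀ {Δ a a′} (t u : Tree Δ) w w′ → Continuation w → Continuation w′ →
    codeFrom a t ++ w ≡ codeFrom a′ u ++ w′ → t ≡ u × w ≡ w′
  parse-tree (node ts p) (node us q) w w′ cw cw′ eq
    with parse-children ts us w w′ cw cw′ (proj₂ (∷-injective eq))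
  ... | refl , refl = cong (node ts) (≤-irrelevant p q) , refl

  -- The same for the labels of a list of siblings.  The first letter
  -- separates the cases "no child" (a continuation letter), "one child"
  -- (s) and "several children" (ℓ).
  parse-children : ∀ {Δ} (ts us : List (Tree Δ)) w w′ → Continuation w → Continuation w′ →
    children ts ++ w ≡ children us ++ w′ → ts ≡ us × w ≡ w′
  parse-children []  [] w w′ _ _ eq = refl , eq
  parse-children []  (node _ _ ∷ [])    _ _ () _ refl
  parse-children []  (node _ _ ∷ _ ∷ _) _ _ () _ refl
  parse-children (node _ _ ∷ [])    [] _ _ _ () refl
  parse-children (node _ _ ∷ _ ∷ _) [] _ _ _ () refl
  parse-children (node _ _ ∷ [])    (node _ _ ∷ _ ∷ _) _ _ _ _ ()
  parse-children (node _ _ ∷ _ ∷ _) (node _ _ ∷ [])    _ _ _ _ ()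
  parse-children (t ∷ []) (u ∷ []) w w′ cw cw′ eq
    with parse-tree t u w w′ cw cw′ eq
  ... | refl , refl = refl , refl
  parse-children (t ∷ u ∷ us) (t′ ∷ u′ ∷ us′) w w′ cw cw′ eq
    with parse-tree t t′ _ _ (rightPart-continuation u us w) (rightPart-continuation u′ us′ w′)
           (reassoc (codeFrom ℓ t) (rightPart u us) w (codeFrom ℓ t′) (rightPart u′ us′) w′ eq)
  ... | refl , rest with parse-rightPart u us u′ us′ w w′ cw cw′ rest
  ... | refl , refl , refl = refl , refl

  parse-rightPart : ∀ {Δ} (u : Tree Δ) us u′ us′ w w′ → Continuation w → Continuation w′ →
    rightPart u us ++ w ≡ rightPart u′ us′ ++ w′ → u ≡ u′ × us ≡ us′ × w ≡ w′
  parse-rightPart u [] u′ [] w w′ cw cw′ eq with parse-tree u u′ w w′ cw cw′ eq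
  ... | refl , refl = refl , refl , refl
  parse-rightPart (node _ _) []      (node _ _) (_ ∷ _) _ _ _ _ ()
  parse-rightPart (node _ _) (_ ∷ _) (node _ _) []      _ _ _ _ ()
  parse-rightPart u (v ∷ vs) u′ (v′ ∷ vs′) w w′ cw cw′ eq
    with parse-tree u u′ _ _ (rightPart-continuation v vs w) (rightPart-continuation v′ vs′ w′)
           (reassoc (codeFrom m u) (rightPart v vs) w (codeFrom m u′) (rightPart v′ vs′) w′ eq)
  ... | refl , rest with parse-rightPart v vs v′ vs′ w w′ cw cw′ rest
  ... | refl , refl , refl = refl , refl , refl

codeword-injective : ∀ {Δ} (t u : Tree Δ) → codeword t ≡ codeword u → t ≡ u
codeword-injective t u eq = proj₁ (parse-tree t u [] [] end end
  (trans (++-identityʳ (codeword t)) (trans eq (sym (++-identityʳ (codeword u))))))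

body : ∀ {Δ} → Tree Δ → Word
body (node ts _) = children ts

codeFrom-body : ∀ {Δ} a (t : Tree Δ) → codeFrom a t ≡ a ∷ body t
codeFrom-body a (node _ _) = refl

rightPart-tailWord : ∀ {Δ} (u : Tree Δ) us → rightPart u us ≡ tailWord (body u) (map body us)
rightPart-tailWord u []       = codeFrom-body r u
rightPart-tailWord u (v ∷ vs) = cong₂ _++_ (codeFrom-body m u) (rightPart-tailWord v vs)

children-branchWord : ∀ {Δ} (t u : Tree Δ) us →
  children (t ∷ u ∷ us) ≡ branchWord (body t) (body u) (map body us)
children-branchWord t u us = cong₂ _++_ (codeFrom-body ℓ t) (rightPart-tailWord u us)

mutual
  children-sound : ∀ {Δ} (ts : List (Tree Δ)) → length ts ≤ Δ → CodeSet Δ (children ts)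
  children-sound []                 _ = cs-ε
  children-sound (node vs q ∷ [])   _ = cs-s (children-sound vs q)
  children-sound {Δ} (t ∷ u ∷ us) p =
    subst (CodeSet Δ) (sym (children-branchWord t u us))
      (cs-branch (subst (λ k → suc (suc k) ≤ Δ) (sym (length-map body us)) p)
        (body-sound t) (body-sound u) (bodies-sound us))

  body-sound : ∀ {Δ} (t : Tree Δ) → CodeSet Δ (body t)
  body-sound (node vs q) = children-sound vs q

  bodies-sound : ∀ {Δ} (us : List (Tree Δ)) → All (CodeSet Δ) (map body us)
  bodies-sound []       = []
  bodies-sound (u ∷ us) = body-sound u ∷ bodies-sound us

mutual
  -- Every word of CodeSet labels a list of at most Δ siblings
  -- (1 ≤ Δ is needed to realise  sδ  by a single child).
  children-complete : ∀ {Δ δ} → 1 ≤ Δ → CodeSet Δ δ →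
    Σ (List (Tree Δ)) λ ts → length ts ≤ Δ × children ts ≡ δ
  children-complete h cs-ε = [] , z≤n , refl
  children-complete h (cs-s c) with children-complete h c
  ... | ts , p , refl = node ts p ∷ [] , h , refl
  children-complete {Δ} h (cs-branch len c₁ c₂ cs)
    with children-complete h c₁ | children-complete h c₂ | bodies-complete h cs
  ... | ts₁ , p₁ , refl | ts₂ , p₂ , refl | us , refl =
    node ts₁ p₁ ∷ node ts₂ p₂ ∷ us
    , subst (λ k → suc (suc k) ≤ Δ) (length-map body us) len
    , children-branchWord (node ts₁ p₁) (node ts₂ p₂) us

  bodies-complete : ∀ {Δ xs} → 1 ≤ Δ → All (CodeSet Δ) xs →
    Σ (List (Tree Δ)) λ us → map body us ≡ xs
  bodies-complete h [] = [] , refl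
  bodies-complete h (c ∷ cs) with children-complete h c | bodies-complete h cs
  ... | ts , p , refl | us , refl = node ts p ∷ us , refl

theorem1 : (Δ : ℕ) → 2 ≤ Δ →
    ((t u : Tree Δ) → codeword t ≡ codeword u → t ≡ u)
    × ((t : Tree Δ) → Σ Word (λ δ → CodeSet Δ δ × codeword t ≡ s ∷ δ))
    × ((δ : Word) → CodeSet Δ δ → Σ (Tree Δ) (λ t → codeword t ≡ s ∷ δ))
theorem1 Δ 2≤Δ = codeword-injective , codeword-sound , codeword-complete
  where
  codeword-sound : (t : Tree Δ) → Σ Word (λ δ → CodeSet Δ δ × codeword t ≡ s ∷ δ)
  codeword-sound t = body t , body-sound t , codeFrom-body s t

  codeword-complete : (δ : Word) → CodeSet Δ δ → Σ (Tree Δ) (λ t → codeword t ≡ s ∷ δ)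
  codeword-complete δ c with children-complete (≤-trans (n≤1+n 1) 2≤Δ) c
  ... | ts , p , refl = node ts p , refl
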